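{- For every integer $\gamma\ge0$, the map sending $\diamond_a$ to $\prec_a+\succ_a$ for each $a\in[\gamma]$ extends in a unique way to an operad morphism $\zeta_\gamma:\mathsf{DAs}_\gamma\to\mathsf{Dendr}_\gamma$.
   Context: All operads are nonsymmetric operads over a field $\mathbb{K}$ of characteristic zero; an operad with presentation $(G,R)$ is $\mathbf{Free}(G)/\langle R\rangle$, $\mathbf{Free}(G)$ being the free nonsymmetric operad on binary generators $G$. $[n]=\{1,\dots,n\}$, $a\downarrow a'=\min(a,a')$. $\mathsf{DAs}_\gamma$ is generated by binary elements $\diamond_a$, $a\in[\gamma]$, with relations spanned by $\diamond_a\circ_1\diamond_a-\diamond_a\circ_2\diamond_a$. $\mathsf{Dendr}_\gamma$ is generated by binary elements $\prec_a,\succ_a$, $a\in[\gamma]$, with relations spanned by, for $a,a'\in[\gamma]$: $\prec_a\circ_1\succ_{a'}-\succ_{a'}\circ_2\prec_a$; $\prec_a\circ_1\prec_{a'}-\prec_{a\downarrow a'}\circ_2\prec_a-\prec_{a\downarrow a'}\circ_2\succ_{a'}$; $\succ_{a\downarrow a'}\circ_1\prec_{a'}+\succ_{a\downarrow a'}\circ_1\succ_a-\succ_a\circ_2\succ_{a'}$. -}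

module Defs where

open import Level using (Level; _⊔_) renaming (suc to lsuc)
open import Algebra.Bundles using (CommutativeRing)
open import Data.Nat using (ℕ; zero; suc; _+_)
open import Data.Nat.Properties using (+-assoc; +-comm)
open import Data.Fin using (Fin; zero; suc)
open import Data.Fin.Properties using () renaming (_≟_ to _≟Fin_)
open import Data.List using (List; []; _∷_; _++_; concatMap) renaming (map to mapL)
open import Data.Product using (Σ; ∃; _×_; _,_)
open import Data.Sum using (_⊎_; inj₁; inj₂)
import Data.Sum as Sum
open import Data.Bool using (Bool; true; false; _∧_; if_then_else_)
open import Relation.Nullary using (¬_; Dec; yes; no)
open import Relation.Nullary.Decidable using (⌊_⌋)
open import Relation.Binary.Definitions using (DecidableEquality)
open import Relation.Binary.PropositionalEquality using (_≡_; refl; subst; cong; sym; trans)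

natCast : ∀ {c ℓ} (R : CommutativeRing c ℓ) → ℕ → CommutativeRing.Carrier R
natCast R zero    = CommutativeRing.0# R
natCast R (suc n) = CommutativeRing._+_ R (CommutativeRing.1# R) (natCast R n)

record CharZeroField (c ℓ : Level) : Set (lsuc (c ⊔ ℓ)) where
  field
    commRing : CommutativeRing c ℓ
  open CommutativeRing commRing public
  field
    0≉1      : ¬ (0# ≈ 1#)
    inverse  : ∀ x → ¬ (x ≈ 0#) → ∃ λ y → (x * y) ≈ 1#
    charZero : ∀ n → natCast commRing n ≈ 0# → n ≡ 0

-- CONVENTION: Op k is the space of operations of arity (suc k)
-- (all operads considered here have no nullary operations).
-- x ∘⟨ i ⟩ y is the partial composition x ∘_{i+1} y.

record LinOperad {c ℓ : Level} (K : CharZeroField c ℓ) (o e : Level)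
       : Set (c ⊔ lsuc (o ⊔ e)) where
  open CharZeroField K using (Carrier)
  infix 4 _≈_
  field
    Op     : ℕ → Set o
    _≈_    : ∀ {k} → Op k → Op k → Set e
    0ₒ     : ∀ {k} → Op k
    _+ₒ_   : ∀ {k} → Op k → Op k → Op k
    _·ₒ_   : ∀ {k} → Carrier → Op k → Op k
    𝟙      : Op 0
    _∘⟨_⟩_ : ∀ {a b} → Op a → Fin (suc a) → Op b → Op (a + b)

record Morphism {c ℓ o e o' e' : Level} {K : CharZeroField c ℓ}
       (P : LinOperad K o e) (Q : LinOperad K o' e')
       : Set (c ⊔ o ⊔ e ⊔ o' ⊔ e') where
  private
    module P = LinOperad P
    module Q = LinOperad Q
  open CharZeroField K using (Carrier)
  field
    map    : ∀ {k} → P.Op k → Q.Op k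
    map-≈  : ∀ {k} {x y : P.Op k} → x P.≈ y → map x Q.≈ map y
    map-+  : ∀ {k} (x y : P.Op k) → map (x P.+ₒ y) Q.≈ (map x Q.+ₒ map y)
    map-·  : ∀ {k} (λ' : Carrier) (x : P.Op k) → map (λ' P.·ₒ x) Q.≈ (λ' Q.·ₒ map x)
    map-∘  : ∀ {a b} (x : P.Op a) (i : Fin (suc a)) (y : P.Op b) →
             map (x P.∘⟨ i ⟩ y) Q.≈ (map x Q.∘⟨ i ⟩ map y)
    map-𝟙  : map P.𝟙 Q.≈ Q.𝟙

module Presented {c ℓ : Level} (K : CharZeroField c ℓ)
                 (G : Set) (_≟G_ : DecidableEquality G) where
  open CharZeroField K using (Carrier; 0#; 1#; -_; _≈_)
    renaming (_+_ to _+K_; _*_ to _*K_)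

  -- planar binary trees with internal nodes labelled by G;
  -- Tree k has (suc k) leaves
  data Tree : ℕ → Set where
    leaf : Tree 0
    node : ∀ {a b} → G → Tree a → Tree b → Tree (suc (a + b))

  eqT : ∀ {a b} → Tree a → Tree b → Bool
  eqT leaf leaf = true
  eqT leaf (node _ _ _) = false
  eqT (node _ _ _) leaf = false
  eqT (node g l r) (node g' l' r') = ⌊ g ≟G g' ⌋ ∧ (eqT l l' ∧ eqT r r')

  -- leaves of node g l r (l with suc a leaves, r with suc b leaves),
  -- numbered from left to right
  split : ∀ a b → Fin (suc (suc (a + b))) → Fin (suc a) ⊎ Fin (suc b)
  split zero    b zero    = inj₁ zero
  split zero    b (suc j) = inj₂ j
  split (suc a) b zero    = inj₁ zero
  split (suc a) b (suc j) = Sum.map suc (λ x → x) (split a b j)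

  private
    eq₁ : ∀ a b c → 1 + ((a + c) + b) ≡ 1 + ((a + b) + c)
    eq₁ a b c = cong (1 +_) (trans (+-assoc a c b)
                  (trans (cong (a +_) (+-comm c b)) (sym (+-assoc a b c))))
    eq₂ : ∀ a b c → 1 + (a + (b + c)) ≡ 1 + ((a + b) + c)
    eq₂ a b c = cong (1 +_) (sym (+-assoc a b c))

  graft : ∀ {a c} → Tree a → Fin (suc a) → Tree c → Tree (a + c)
  graft leaf zero s = s
  graft {c = c} (node {a₁} {a₂} g l r) i s with split a₁ a₂ i
  ... | inj₁ j = subst Tree (eq₁ a₁ a₂ c) (node g (graft l j s) r)
  ... | inj₂ j = subst Tree (eq₂ a₁ a₂ c) (node g l (graft r j s))

  -- elements of Free(G): formal K-linear combinations of trees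
  Lin : ℕ → Set c
  Lin k = List (Carrier × Tree k)

  zeroL : ∀ {k} → Lin k
  zeroL = []

  _⊕_ : ∀ {k} → Lin k → Lin k → Lin k
  x ⊕ y = x ++ y

  _⊙_ : ∀ {k} → Carrier → Lin k → Lin k
  λ' ⊙ x = mapL (λ { (μ , t) → (λ' *K μ , t) }) x

  _⊖_ : ∀ {k} → Lin k → Lin k → Lin k
  x ⊖ y = x ⊕ ((- 1#) ⊙ y)

  compL : ∀ {a b} → Lin a → Fin (suc a) → Lin b → Lin (a + b)
  compL x i y = concatMap (λ { (λ' , t) → mapL (λ { (μ , s) → (λ' *K μ , graft t i s) }) y }) x

  unitL : Lin 0
  unitL = (1# , leaf) ∷ []

  genL : G → Lin 1
  genL g = (1# , node g leaf leaf) ∷ []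

  coeff : ∀ {k} → Tree k → Lin k → Carrier
  coeff t [] = 0#
  coeff t ((λ' , s) ∷ x) = if eqT t s then λ' +K coeff t x else coeff t x

  _≈F_ : ∀ {k} → Lin k → Lin k → Set ℓ
  x ≈F y = ∀ t → coeff t x ≈ coeff t y

  -- the operad ideal generated by a family of relations (of arity 3):
  -- the smallest subspace containing them and closed under partial
  -- compositions with arbitrary elements on either side
  data InIdeal {I : Set} (rel : I → Lin 2) : ∀ {k} → Lin k → Set (c ⊔ ℓ) where
    gen   : ∀ i → InIdeal rel (rel i)
    zero  : ∀ {k} → InIdeal rel (zeroL {k})
    add   : ∀ {k} {x y : Lin k} → InIdeal rel x → InIdeal rel y → InIdeal rel (x ⊕ y)
    scale : ∀ {k} (λ' : Carrier) {x : Lin k} → InIdeal rel x → InIdeal rel (λ' ⊙ x)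
    compˡ : ∀ {a b} {x : Lin a} (i : Fin (suc a)) (y : Lin b) →
            InIdeal rel x → InIdeal rel (compL x i y)
    compʳ : ∀ {a b} (x : Lin a) (i : Fin (suc a)) {y : Lin b} →
            InIdeal rel y → InIdeal rel (compL x i y)
    resp  : ∀ {k} {x y : Lin k} → x ≈F y → InIdeal rel x → InIdeal rel y

  presented : {I : Set} → (I → Lin 2) → LinOperad K c (c ⊔ ℓ)
  presented rel = record
    { Op     = Lin
    ; _≈_    = λ x y → InIdeal rel (x ⊖ y)
    ; 0ₒ     = zeroL
    ; _+ₒ_   = _⊕_
    ; _·ₒ_   = _⊙_
    ; 𝟙      = unitL
    ; _∘⟨_⟩_ = compL
    }

-- [γ] is modelled by Fin γ (order preserved); min on it

_↓_ : ∀ {n} → Fin n → Fin n → Fin n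
zero  ↓ _     = zero
suc a ↓ zero  = zero
suc a ↓ suc b = suc (a ↓ b)

pos₁ pos₂ : Fin 2
pos₁ = zero
pos₂ = suc zero

module Operads {c ℓ : Level} (K : CharZeroField c ℓ) (γ : ℕ) where
  open CharZeroField K using (1#; -_)

  module DA = Presented K (Fin γ) _≟Fin_

  DAsRel : Fin γ → DA.Lin 2
  DAsRel a = DA.compL (DA.genL a) pos₁ (DA.genL a) DA.⊖ DA.compL (DA.genL a) pos₂ (DA.genL a)

  DAs : LinOperad K c (c ⊔ ℓ)
  DAs = DA.presented DAsRel

  ◇ : Fin γ → LinOperad.Op DAs 1
  ◇ a = DA.genL a

  data DGen : Set where
    ≺ ≻ : Fin γ → DGen

  _≟D_ : DecidableEquality DGen
  ≺ a ≟D ≺ b with a ≟Fin b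
  ... | yes refl = yes refl
  ... | no ne = no λ { refl → ne refl }
  ≺ a ≟D ≻ b = no λ ()
  ≻ a ≟D ≺ b = no λ ()
  ≻ a ≟D ≻ b with a ≟Fin b
  ... | yes refl = yes refl
  ... | no ne = no λ { refl → ne refl }

  module DD = Presented K DGen _≟D_

  g≺ g≻ : Fin γ → DD.Lin 1
  g≺ a = DD.genL (≺ a)
  g≻ a = DD.genL (≻ a)

  DendrRel : Fin 3 × Fin γ × Fin γ → DD.Lin 2
  DendrRel (zero , a , a') =
    DD.compL (g≺ a) pos₁ (g≻ a') DD.⊖ DD.compL (g≻ a') pos₂ (g≺ a)
  DendrRel (suc zero , a , a') =
    DD.compL (g≺ a) pos₁ (g≺ a')
      DD.⊖ (DD.compL (g≺ (a ↓ a')) pos₂ (g≺ a) DD.⊕ DD.compL (g≺ (a ↓ a')) pos₂ (g≻ a'))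
  DendrRel (suc (suc zero) , a , a') =
    (DD.compL (g≻ (a ↓ a')) pos₁ (g≺ a') DD.⊕ DD.compL (g≻ (a ↓ a')) pos₁ (g≻ a))
      DD.⊖ DD.compL (g≻ a) pos₂ (g≻ a')

  Dendr : LinOperad K c (c ⊔ ℓ)
  Dendr = DD.presented DendrRel

  ≺+≻ : Fin γ → LinOperad.Op Dendr 1
  ≺+≻ a = g≺ a DD.⊕ g≻ a

  Extends : Morphism DAs Dendr → Set (c ⊔ ℓ)
  Extends φ = ∀ a → LinOperad._≈_ Dendr (Morphism.map φ (◇ a)) (≺+≻ a)

-- ζ sends a planar tree whose nodes are labelled in [γ] to the sum of its orientations, the trees
-- obtained by replacing each label a by ≺_a or ≻_a.  Orienting a grafted tree is grafting orientations,
-- so ζ commutes with partial composition; a Dendr tree is an orientation of exactly one DAs tree, so ζ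
-- preserves equality of coefficients; and ζ of the associativity relation of ◇_a is the sum of the three
-- dendriform relations at a = a' (where a ↓ a = a).  Hence ζ maps the ideal of DAs into that of Dendr.
-- It is the only extension because every tree is an iterated composition of generators.
-- Identities between formal combinations are proved by pairing them with an arbitrary function f on
-- trees, ⟪ f , Σ λᵢ tᵢ ⟫ = Σ λᵢ f tᵢ: the pairing is linear, turns composition into a double sum, and
-- recovers coefficients when f is an indicator.

module Submission where

open import Defs
open import Level using (Level; _⊔_)
open import Algebra.Bundles using (CommutativeRing)
open import Data.Bool using (Bool; true; false; _∧_; if_then_else_)
open import Data.Fin using (Fin; zero; suc; toℕ; fromℕ)
open import Data.Fin.Properties using (toℕ-fromℕ) renaming (_≟_ to _≟Fin_)
open import Data.List using (List; []; _∷_; _++_; concatMap) renaming (map to mapL)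
open import Data.Maybe using (nothing)
open import Data.Nat as ℕ using (ℕ; zero; suc) renaming (_+_ to _+ℕ_)
import Data.Nat.Properties as ℕₚ
open import Data.Product using (Σ; _×_; _,_; uncurry)
open import Data.Sum using (inj₁; inj₂)
import Data.Sum as Sum
open import Relation.Nullary using (yes; no)
open import Relation.Nullary.Decidable using (⌊_⌋)
open import Relation.Binary.Bundles using (Setoid)
open import Relation.Binary.Definitions using (DecidableEquality)
open import Relation.Binary.PropositionalEquality as ≡ using (_≡_)
open import Tactic.RingSolver.Core.AlmostCommutativeRing using (fromCommutativeRing)
import Algebra.Properties.CommutativeSemigroup as CommutativeSemigroupProperties
import Algebra.Properties.Ring as RingProperties
import Relation.Binary.Reasoning.Setoid as SetoidReasoning
import Tactic.RingSolver.NonReflective as RingSolver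

module Pairing {c ℓ} (R : CommutativeRing c ℓ) where
  open CommutativeRing R
  open SetoidReasoning setoid
  open CommutativeSemigroupProperties +-commutativeSemigroup using (interchange)
  open RingProperties ring using (-1*x≈-x; -‿involutive)
  open RingSolver (fromCommutativeRing R (λ _ → nothing)) using (solve; _⊕_; _⊗_; _⊜_)

  -1# : Carrier
  -1# = - 1#

  -1#*-1#≈1# : -1# * -1# ≈ 1#
  -1#*-1#≈1# = trans (-1*x≈-x -1#) (-‿involutive 1#)

  x+-1#*x≈0# : ∀ x → x + -1# * x ≈ 0#
  x+-1#*x≈0# x = trans (+-cong refl (-1*x≈-x x)) (-‿inverseʳ x)

  telescope : ∀ x y z → (x + -1# * y) + (y + -1# * z) ≈ x + -1# * z
  telescope x y z = begin
    (x + -1# * y) + (y + -1# * z) ≈⟨ regroup x y z -1# ⟩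
    x + ((y + -1# * y) + -1# * z) ≈⟨ +-congˡ (+-congʳ (x+-1#*x≈0# y)) ⟩
    x + (0# + -1# * z)            ≈⟨ +-congˡ (+-identityˡ _) ⟩
    x + -1# * z                   ∎
    where
    regroup : ∀ x y z m → (x + m * y) + (y + m * z) ≈ x + ((y + m * y) + m * z)
    regroup = solve 4 (λ x y z m → ((x ⊕ m ⊗ y) ⊕ (y ⊕ m ⊗ z)) ⊜ (x ⊕ ((y ⊕ m ⊗ y) ⊕ m ⊗ z))) refl

  -1#*[x+-1#*y]≈y+-1#*x : ∀ x y → -1# * (x + -1# * y) ≈ y + -1# * x
  -1#*[x+-1#*y]≈y+-1#*x x y = begin
    -1# * (x + -1# * y)          ≈⟨ distribˡ -1# x (-1# * y) ⟩
    -1# * x + -1# * (-1# * y)    ≈⟨ +-congˡ (*-assoc -1# -1# y) ⟨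
    -1# * x + (-1# * -1#) * y    ≈⟨ +-congˡ (trans (*-congʳ -1#*-1#≈1#) (*-identityˡ y)) ⟩
    -1# * x + y                  ≈⟨ +-comm _ _ ⟩
    y + -1# * x                  ∎

  ⟪_,_⟫ : {X : Set} → (X → Carrier) → List (Carrier × X) → Carrier
  ⟪ f , [] ⟫          = 0#
  ⟪ f , (λ' , t) ∷ x ⟫ = λ' * f t + ⟪ f , x ⟫

  module _ {X : Set} where

    ⟪⟫-cong : ∀ {f g : X → Carrier} x → (∀ t → f t ≈ g t) → ⟪ f , x ⟫ ≈ ⟪ g , x ⟫
    ⟪⟫-cong []             f≈g = refl
    ⟪⟫-cong ((λ' , t) ∷ x) f≈g = +-cong (*-congˡ (f≈g t)) (⟪⟫-cong x f≈g)

    ⟪⟫-++ : ∀ (f : X → Carrier) x y → ⟪ f , x ++ y ⟫ ≈ ⟪ f , x ⟫ + ⟪ f , y ⟫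
    ⟪⟫-++ f []             y = sym (+-identityˡ _)
    ⟪⟫-++ f ((λ' , t) ∷ x) y = trans (+-congˡ (⟪⟫-++ f x y)) (sym (+-assoc _ _ _))

    ⟪0⟫ : ∀ x → ⟪ (λ (_ : X) → 0#) , x ⟫ ≈ 0#
    ⟪0⟫ []             = refl
    ⟪0⟫ ((λ' , t) ∷ x) = trans (+-cong (zeroʳ λ') (⟪0⟫ x)) (+-identityˡ 0#)

    ⟪+⟫ : ∀ (f g : X → Carrier) x → ⟪ (λ t → f t + g t) , x ⟫ ≈ ⟪ f , x ⟫ + ⟪ g , x ⟫
    ⟪+⟫ f g []             = sym (+-identityˡ 0#)
    ⟪+⟫ f g ((λ' , t) ∷ x) = begin
      λ' * (f t + g t) + ⟪ (λ t → f t + g t) , x ⟫      ≈⟨ +-cong (distribˡ λ' _ _) (⟪+⟫ f g x) ⟩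
      (λ' * f t + λ' * g t) + (⟪ f , x ⟫ + ⟪ g , x ⟫)    ≈⟨ interchange _ _ _ _ ⟩
      (λ' * f t + ⟪ f , x ⟫) + (λ' * g t + ⟪ g , x ⟫)    ∎

    ⟪*⟫ : ∀ κ (f : X → Carrier) x → ⟪ (λ t → κ * f t) , x ⟫ ≈ κ * ⟪ f , x ⟫
    ⟪*⟫ κ f []             = sym (zeroʳ κ)
    ⟪*⟫ κ f ((λ' , t) ∷ x) = begin
      λ' * (κ * f t) + ⟪ (λ t → κ * f t) , x ⟫   ≈⟨ +-cong (x∙yz≈y∙xz λ' κ (f t)) (⟪*⟫ κ f x) ⟩
      κ * (λ' * f t) + κ * ⟪ f , x ⟫             ≈⟨ distribˡ κ _ _ ⟨
      κ * (λ' * f t + ⟪ f , x ⟫)                 ∎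
      where open CommutativeSemigroupProperties *-commutativeSemigroup using (x∙yz≈y∙xz)

  ⟪⟫-swap : ∀ {X Y : Set} (h : X → Y → Carrier) x y →
            ⟪ (λ t → ⟪ h t , y ⟫) , x ⟫ ≈ ⟪ (λ s → ⟪ (λ t → h t s) , x ⟫) , y ⟫
  ⟪⟫-swap h []             y = sym (⟪0⟫ y)
  ⟪⟫-swap h ((λ' , t) ∷ x) y = begin
    λ' * ⟪ h t , y ⟫ + ⟪ (λ t → ⟪ h t , y ⟫) , x ⟫
      ≈⟨ +-cong (sym (⟪*⟫ λ' (h t) y)) (⟪⟫-swap h x y) ⟩
    ⟪ (λ s → λ' * h t s) , y ⟫ + ⟪ (λ s → ⟪ (λ t → h t s) , x ⟫) , y ⟫
      ≈⟨ ⟪+⟫ _ _ y ⟨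
    ⟪ (λ s → λ' * h t s + ⟪ (λ t → h t s) , x ⟫) , y ⟫
      ∎

  ⟪⟫-product : ∀ {X Y : Set} (f : X → Carrier) (g : Y → Carrier) x y →
               ⟪ (λ t → ⟪ (λ s → f t * g s) , y ⟫) , x ⟫ ≈ ⟪ f , x ⟫ * ⟪ g , y ⟫
  ⟪⟫-product f g x y = begin
    ⟪ (λ t → ⟪ (λ s → f t * g s) , y ⟫) , x ⟫ ≈⟨ ⟪⟫-cong x (λ t → ⟪*⟫ (f t) g y) ⟩
    ⟪ (λ t → f t * ⟪ g , y ⟫) , x ⟫           ≈⟨ ⟪⟫-cong x (λ t → *-comm (f t) _) ⟩
    ⟪ (λ t → ⟪ g , y ⟫ * f t) , x ⟫           ≈⟨ ⟪*⟫ _ f x ⟩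
    ⟪ g , y ⟫ * ⟪ f , x ⟫                     ≈⟨ *-comm _ _ ⟩
    ⟪ f , x ⟫ * ⟪ g , y ⟫                     ∎

  ⟪⟫-map : ∀ {X Y : Set} (f : Y → Carrier) (g : Carrier × X → Carrier × Y) κ (h : X → Y) →
           (∀ μ s → g (μ , s) ≡ (κ * μ , h s)) →
           ∀ x → ⟪ f , mapL g x ⟫ ≈ κ * ⟪ (λ s → f (h s)) , x ⟫
  ⟪⟫-map f g κ h g≡ []            = sym (zeroʳ κ)
  ⟪⟫-map f g κ h g≡ ((μ , s) ∷ x) rewrite g≡ μ s = begin
    (κ * μ) * f (h s) + ⟪ f , mapL g x ⟫              ≈⟨ +-cong (*-assoc _ _ _) (⟪⟫-map f g κ h g≡ x) ⟩
    κ * (μ * f (h s)) + κ * ⟪ (λ s → f (h s)) , x ⟫   ≈⟨ distribˡ _ _ _ ⟨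
    κ * (μ * f (h s) + ⟪ (λ s → f (h s)) , x ⟫)       ∎

  ⟪⟫-concatMap : ∀ {X Y : Set} (f : Y → Carrier) (F : Carrier × X → List (Carrier × Y)) (h : X → Carrier) →
                 (∀ λ' t → ⟪ f , F (λ' , t) ⟫ ≈ λ' * h t) →
                 ∀ x → ⟪ f , concatMap F x ⟫ ≈ ⟪ h , x ⟫
  ⟪⟫-concatMap f F h F≈ []             = refl
  ⟪⟫-concatMap f F h F≈ ((λ' , t) ∷ x) =
    trans (⟪⟫-++ f (F (λ' , t)) (concatMap F x)) (+-cong (F≈ λ' t) (⟪⟫-concatMap f F h F≈ x))

  indicator : Bool → Carrier
  indicator b = if b then 1# else 0#

  indicator-∧ : ∀ p q → indicator (p ∧ q) ≈ indicator p * indicator q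
  indicator-∧ true  q = sym (*-identityˡ _)
  indicator-∧ false q = sym (zeroˡ _)

  ⟪indicator-∧⟫ : ∀ {X Y : Set} b (P : X → Bool) (Q : Y → Bool) x y {p q} →
                  ⟪ (λ t → indicator (P t)) , x ⟫ ≈ indicator p → ⟪ (λ s → indicator (Q s)) , y ⟫ ≈ indicator q →
                  ⟪ (λ t → ⟪ (λ s → indicator (b ∧ (P t ∧ Q s))) , y ⟫) , x ⟫ ≈ indicator (b ∧ (p ∧ q))
  ⟪indicator-∧⟫ b P Q x y {p} {q} ⟪P⟫ ⟪Q⟫ = begin
    ⟪ (λ t → ⟪ (λ s → indicator (b ∧ (P t ∧ Q s))) , y ⟫) , x ⟫
      ≈⟨ ⟪⟫-cong x (λ t → ⟪⟫-cong y (λ s → split∧ (P t) (Q s))) ⟩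
    ⟪ (λ t → ⟪ (λ s → (indicator b * indicator (P t)) * indicator (Q s)) , y ⟫) , x ⟫
      ≈⟨ ⟪⟫-product _ _ x y ⟩
    ⟪ (λ t → indicator b * indicator (P t)) , x ⟫ * ⟪ (λ s → indicator (Q s)) , y ⟫
      ≈⟨ *-cong (trans (⟪*⟫ _ _ x) (*-congˡ ⟪P⟫)) ⟪Q⟫ ⟩
    (indicator b * indicator p) * indicator q
      ≈⟨ split∧ p q ⟨
    indicator (b ∧ (p ∧ q))
      ∎
    where
    split∧ : ∀ p q → indicator (b ∧ (p ∧ q)) ≈ (indicator b * indicator p) * indicator q
    split∧ p q = trans (indicator-∧ b (p ∧ q)) (trans (*-congˡ (indicator-∧ p q)) (sym (*-assoc _ _ _)))

module FreeOperad {c ℓ} (K : CharZeroField c ℓ) (G : Set) (_≟G_ : DecidableEquality G) where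
  open CharZeroField K hiding (zero)
  open Presented K G _≟G_
  open Pairing commRing
  open SetoidReasoning setoid

  ⟪⟫-⊙ : ∀ {k} (f : Tree k → Carrier) κ x → ⟪ f , κ ⊙ x ⟫ ≈ κ * ⟪ f , x ⟫
  ⟪⟫-⊙ f κ = ⟪⟫-map f _ κ (λ s → s) (λ _ _ → ≡.refl)

  ⟪⟫-⊖ : ∀ {k} (f : Tree k → Carrier) x y → ⟪ f , x ⊖ y ⟫ ≈ ⟪ f , x ⟫ + -1# * ⟪ f , y ⟫
  ⟪⟫-⊖ f x y = trans (⟪⟫-++ f x _) (+-congˡ (⟪⟫-⊙ f -1# y))

  ⟪⟫-compL : ∀ {a b} (f : Tree (a +ℕ b) → Carrier) x i (y : Lin b) →
             ⟪ f , compL x i y ⟫ ≈ ⟪ (λ t → ⟪ (λ s → f (graft t i s)) , y ⟫) , x ⟫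
  ⟪⟫-compL f x i y = ⟪⟫-concatMap f _ _ (λ λ' t → ⟪⟫-map f _ λ' (λ s → graft t i s) (λ _ _ → ≡.refl) y) x

  coeff≈⟪indicator⟫ : ∀ {k} (u : Tree k) x → coeff u x ≈ ⟪ (λ t → indicator (eqT u t)) , x ⟫
  coeff≈⟪indicator⟫ u []             = refl
  coeff≈⟪indicator⟫ u ((λ' , s) ∷ x) with eqT u s
  ... | true  = +-cong (sym (*-identityʳ λ')) (coeff≈⟪indicator⟫ u x)
  ... | false = trans (coeff≈⟪indicator⟫ u x) (trans (sym (+-identityˡ _)) (+-congʳ (sym (zeroʳ λ'))))

  infix 4 _≋_
  record _≋_ {k} (x y : Lin k) : Set (c ⊔ ℓ) where
    constructor mk≋
    field ⟪⟫-≈ : ∀ f → ⟪ f , x ⟫ ≈ ⟪ f , y ⟫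
  open _≋_ public

  ≋⇒≈F : ∀ {k} {x y : Lin k} → x ≋ y → x ≈F y
  ≋⇒≈F {x = x} {y} x≋y u = begin
    coeff u x                                ≈⟨ coeff≈⟪indicator⟫ u x ⟩
    ⟪ (λ t → indicator (eqT u t)) , x ⟫      ≈⟨ ⟪⟫-≈ x≋y _ ⟩
    ⟪ (λ t → indicator (eqT u t)) , y ⟫      ≈⟨ coeff≈⟪indicator⟫ u y ⟨
    coeff u y                                ∎

  ≋-sym : ∀ {k} {x y : Lin k} → x ≋ y → y ≋ x
  ≋-sym x≋y = mk≋ λ f → sym (⟪⟫-≈ x≋y f)

  ≋⇒zeroL≋⊖ : ∀ {k} {x y : Lin k} → x ≋ y → zeroL ≋ x ⊖ y
  ≋⇒zeroL≋⊖ {x = x} {y} x≋y = mk≋ λ f → sym (begin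
    ⟪ f , x ⊖ y ⟫                  ≈⟨ ⟪⟫-⊖ f x y ⟩
    ⟪ f , x ⟫ + -1# * ⟪ f , y ⟫    ≈⟨ +-congʳ (⟪⟫-≈ x≋y f) ⟩
    ⟪ f , y ⟫ + -1# * ⟪ f , y ⟫    ≈⟨ x+-1#*x≈0# _ ⟩
    0#                             ∎)

  -1#⊙[x⊖y]≋y⊖x : ∀ {k} (x y : Lin k) → -1# ⊙ (x ⊖ y) ≋ y ⊖ x
  -1#⊙[x⊖y]≋y⊖x x y = mk≋ λ f → begin
    ⟪ f , -1# ⊙ (x ⊖ y) ⟫                  ≈⟨ ⟪⟫-⊙ f -1# (x ⊖ y) ⟩
    -1# * ⟪ f , x ⊖ y ⟫                    ≈⟨ *-congˡ (⟪⟫-⊖ f x y) ⟩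
    -1# * (⟪ f , x ⟫ + -1# * ⟪ f , y ⟫)    ≈⟨ -1#*[x+-1#*y]≈y+-1#*x _ _ ⟩
    ⟪ f , y ⟫ + -1# * ⟪ f , x ⟫            ≈⟨ ⟪⟫-⊖ f y x ⟨
    ⟪ f , y ⊖ x ⟫                          ∎

  [x⊖y]⊕[y⊖z]≋x⊖z : ∀ {k} (x y z : Lin k) → (x ⊖ y) ⊕ (y ⊖ z) ≋ x ⊖ z
  [x⊖y]⊕[y⊖z]≋x⊖z x y z = mk≋ λ f → begin
    ⟪ f , (x ⊖ y) ⊕ (y ⊖ z) ⟫                                    ≈⟨ ⟪⟫-++ f (x ⊖ y) (y ⊖ z) ⟩
    ⟪ f , x ⊖ y ⟫ + ⟪ f , y ⊖ z ⟫                                ≈⟨ +-cong (⟪⟫-⊖ f x y) (⟪⟫-⊖ f y z) ⟩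
    (⟪ f , x ⟫ + -1# * ⟪ f , y ⟫) + (⟪ f , y ⟫ + -1# * ⟪ f , z ⟫) ≈⟨ telescope _ _ _ ⟩
    ⟪ f , x ⟫ + -1# * ⟪ f , z ⟫                                  ≈⟨ ⟪⟫-⊖ f x z ⟨
    ⟪ f , x ⊖ z ⟫                                                ∎

  [x⊖x']⊕[y⊖y']≋[x⊕y]⊖[x'⊕y'] : ∀ {k} (x x' y y' : Lin k) → (x ⊖ x') ⊕ (y ⊖ y') ≋ (x ⊕ y) ⊖ (x' ⊕ y')
  [x⊖x']⊕[y⊖y']≋[x⊕y]⊖[x'⊕y'] x x' y y' = mk≋ λ f → begin
    ⟪ f , (x ⊖ x') ⊕ (y ⊖ y') ⟫                                      ≈⟨ ⟪⟫-++ f (x ⊖ x') (y ⊖ y') ⟩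
    ⟪ f , x ⊖ x' ⟫ + ⟪ f , y ⊖ y' ⟫                                  ≈⟨ +-cong (⟪⟫-⊖ f x x') (⟪⟫-⊖ f y y') ⟩
    (⟪ f , x ⟫ + -1# * ⟪ f , x' ⟫) + (⟪ f , y ⟫ + -1# * ⟪ f , y' ⟫)  ≈⟨ interchange _ _ _ _ ⟩
    (⟪ f , x ⟫ + ⟪ f , y ⟫) + (-1# * ⟪ f , x' ⟫ + -1# * ⟪ f , y' ⟫)  ≈⟨ +-cong (⟪⟫-++ f x y) (distribˡ -1# _ _) ⟨
    ⟪ f , x ⊕ y ⟫ + -1# * (⟪ f , x' ⟫ + ⟪ f , y' ⟫)                  ≈⟨ +-congˡ (*-congˡ (⟪⟫-++ f x' y')) ⟨
    ⟪ f , x ⊕ y ⟫ + -1# * ⟪ f , x' ⊕ y' ⟫                            ≈⟨ ⟪⟫-⊖ f (x ⊕ y) (x' ⊕ y') ⟨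
    ⟪ f , (x ⊕ y) ⊖ (x' ⊕ y') ⟫                                      ∎
    where open CommutativeSemigroupProperties +-commutativeSemigroup using (interchange)

  ⊙-distrib-⊖ : ∀ {k} κ (x y : Lin k) → κ ⊙ (x ⊖ y) ≋ (κ ⊙ x) ⊖ (κ ⊙ y)
  ⊙-distrib-⊖ κ x y = mk≋ λ f → begin
    ⟪ f , κ ⊙ (x ⊖ y) ⟫                        ≈⟨ ⟪⟫-⊙ f κ (x ⊖ y) ⟩
    κ * ⟪ f , x ⊖ y ⟫                          ≈⟨ *-congˡ (⟪⟫-⊖ f x y) ⟩
    κ * (⟪ f , x ⟫ + -1# * ⟪ f , y ⟫)          ≈⟨ distribˡ κ _ _ ⟩
    κ * ⟪ f , x ⟫ + κ * (-1# * ⟪ f , y ⟫)      ≈⟨ +-congˡ (x∙yz≈y∙xz κ -1# _) ⟩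
    κ * ⟪ f , x ⟫ + -1# * (κ * ⟪ f , y ⟫)      ≈⟨ +-cong (⟪⟫-⊙ f κ x) (*-congˡ (⟪⟫-⊙ f κ y)) ⟨
    ⟪ f , κ ⊙ x ⟫ + -1# * ⟪ f , κ ⊙ y ⟫        ≈⟨ ⟪⟫-⊖ f (κ ⊙ x) (κ ⊙ y) ⟨
    ⟪ f , (κ ⊙ x) ⊖ (κ ⊙ y) ⟫                  ∎
    where open CommutativeSemigroupProperties *-commutativeSemigroup using (x∙yz≈y∙xz)

  compL-distribʳ-⊖ : ∀ {a b} (x x' : Lin a) i (y : Lin b) → compL (x ⊖ x') i y ≋ compL x i y ⊖ compL x' i y
  compL-distribʳ-⊖ x x' i y = mk≋ λ f → let g = λ t → ⟪ (λ s → f (graft t i s)) , y ⟫ in begin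
    ⟪ f , compL (x ⊖ x') i y ⟫                              ≈⟨ ⟪⟫-compL f (x ⊖ x') i y ⟩
    ⟪ g , x ⊖ x' ⟫                                          ≈⟨ ⟪⟫-⊖ g x x' ⟩
    ⟪ g , x ⟫ + -1# * ⟪ g , x' ⟫                            ≈⟨ +-cong (⟪⟫-compL f x i y) (*-congˡ (⟪⟫-compL f x' i y)) ⟨
    ⟪ f , compL x i y ⟫ + -1# * ⟪ f , compL x' i y ⟫        ≈⟨ ⟪⟫-⊖ f (compL x i y) (compL x' i y) ⟨
    ⟪ f , compL x i y ⊖ compL x' i y ⟫                      ∎

  compL-distribˡ-⊖ : ∀ {a b} (x : Lin a) i (y y' : Lin b) → compL x i (y ⊖ y') ≋ compL x i y ⊖ compL x i y'
  compL-distribˡ-⊖ x i y y' = mk≋ λ f → let _∘graft_ = λ f t s → f (graft t i s) in begin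
    ⟪ f , compL x i (y ⊖ y') ⟫                                          ≈⟨ ⟪⟫-compL f x i (y ⊖ y') ⟩
    ⟪ (λ t → ⟪ f ∘graft t , y ⊖ y' ⟫) , x ⟫                             ≈⟨ ⟪⟫-cong x (λ t → ⟪⟫-⊖ (f ∘graft t) y y') ⟩
    ⟪ (λ t → ⟪ f ∘graft t , y ⟫ + -1# * ⟪ f ∘graft t , y' ⟫) , x ⟫      ≈⟨ ⟪+⟫ _ _ x ⟩
    ⟪ (λ t → ⟪ f ∘graft t , y ⟫) , x ⟫ + ⟪ (λ t → -1# * ⟪ f ∘graft t , y' ⟫) , x ⟫
      ≈⟨ +-congˡ (⟪*⟫ -1# _ x) ⟩
    ⟪ (λ t → ⟪ f ∘graft t , y ⟫) , x ⟫ + -1# * ⟪ (λ t → ⟪ f ∘graft t , y' ⟫) , x ⟫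
      ≈⟨ +-cong (⟪⟫-compL f x i y) (*-congˡ (⟪⟫-compL f x i y')) ⟨
    ⟪ f , compL x i y ⟫ + -1# * ⟪ f , compL x i y' ⟫                    ≈⟨ ⟪⟫-⊖ f (compL x i y) (compL x i y') ⟨
    ⟪ f , compL x i y ⊖ compL x i y' ⟫                                  ∎

  compL-resp-≋ : ∀ {a b} {x x' : Lin a} i {y y' : Lin b} → x ≋ x' → y ≋ y' → compL x i y ≋ compL x' i y'
  compL-resp-≋ {x = x} {x'} i {y} {y'} x≋x' y≋y' = mk≋ λ f → begin
    ⟪ f , compL x i y ⟫                                  ≈⟨ ⟪⟫-compL f x i y ⟩
    ⟪ (λ t → ⟪ (λ s → f (graft t i s)) , y ⟫) , x ⟫     ≈⟨ ⟪⟫-≈ x≋x' _ ⟩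
    ⟪ (λ t → ⟪ (λ s → f (graft t i s)) , y ⟫) , x' ⟫    ≈⟨ ⟪⟫-cong x' (λ t → ⟪⟫-≈ y≋y' _) ⟩
    ⟪ (λ t → ⟪ (λ s → f (graft t i s)) , y' ⟫) , x' ⟫   ≈⟨ ⟪⟫-compL f x' i y' ⟨
    ⟪ f , compL x' i y' ⟫                                ∎

  compL-distribʳ-⊕ : ∀ {a b} (x y : Lin a) i (z : Lin b) → compL (x ⊕ y) i z ≋ compL x i z ⊕ compL y i z
  compL-distribʳ-⊕ x y i z = mk≋ λ f → let g = λ t → ⟪ (λ s → f (graft t i s)) , z ⟫ in begin
    ⟪ f , compL (x ⊕ y) i z ⟫                           ≈⟨ ⟪⟫-compL f (x ⊕ y) i z ⟩
    ⟪ g , x ⊕ y ⟫                                       ≈⟨ ⟪⟫-++ g x y ⟩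
    ⟪ g , x ⟫ + ⟪ g , y ⟫                               ≈⟨ +-cong (⟪⟫-compL f x i z) (⟪⟫-compL f y i z) ⟨
    ⟪ f , compL x i z ⟫ + ⟪ f , compL y i z ⟫           ≈⟨ ⟪⟫-++ f (compL x i z) (compL y i z) ⟨
    ⟪ f , compL x i z ⊕ compL y i z ⟫                   ∎

  compL-distribˡ-⊕ : ∀ {a b} (x : Lin a) i (y z : Lin b) → compL x i (y ⊕ z) ≋ compL x i y ⊕ compL x i z
  compL-distribˡ-⊕ x i y z = mk≋ λ f → let _∘graft_ = λ f t s → f (graft t i s) in begin
    ⟪ f , compL x i (y ⊕ z) ⟫                           ≈⟨ ⟪⟫-compL f x i (y ⊕ z) ⟩
    ⟪ (λ t → ⟪ f ∘graft t , y ⊕ z ⟫) , x ⟫              ≈⟨ ⟪⟫-cong x (λ t → ⟪⟫-++ (f ∘graft t) y z) ⟩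
    ⟪ (λ t → ⟪ f ∘graft t , y ⟫ + ⟪ f ∘graft t , z ⟫) , x ⟫ ≈⟨ ⟪+⟫ _ _ x ⟩
    ⟪ (λ t → ⟪ f ∘graft t , y ⟫) , x ⟫ + ⟪ (λ t → ⟪ f ∘graft t , z ⟫) , x ⟫
      ≈⟨ +-cong (⟪⟫-compL f x i y) (⟪⟫-compL f x i z) ⟨
    ⟪ f , compL x i y ⟫ + ⟪ f , compL x i z ⟫           ≈⟨ ⟪⟫-++ f (compL x i y) (compL x i z) ⟨
    ⟪ f , compL x i y ⊕ compL x i z ⟫                   ∎

  left-graft-arity : ∀ a₁ a₂ b → ℕ.suc ((a₁ +ℕ b) +ℕ a₂) ≡ ℕ.suc ((a₁ +ℕ a₂) +ℕ b)
  left-graft-arity a₁ a₂ b = ≡.cong ℕ.suc (xy∙z≈xz∙y a₁ b a₂)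
    where open CommutativeSemigroupProperties ℕₚ.+-commutativeSemigroup using (xy∙z≈xz∙y)

  right-graft-arity : ∀ a₁ a₂ b → ℕ.suc (a₁ +ℕ (a₂ +ℕ b)) ≡ ℕ.suc ((a₁ +ℕ a₂) +ℕ b)
  right-graft-arity a₁ a₂ b = ≡.cong ℕ.suc (≡.sym (ℕₚ.+-assoc a₁ a₂ b))

  graft-node-left : ∀ {a₁ a₂ b} g (l : Tree a₁) (r : Tree a₂) (s : Tree b) i j → split a₁ a₂ i ≡ inj₁ j →
                    graft (node g l r) i s ≡ ≡.subst Tree (left-graft-arity a₁ a₂ b) (node g (graft l j s) r)
  graft-node-left {a₁} {a₂} {b} g l r s i j split≡ with split a₁ a₂ i | split≡
  ... | _ | ≡.refl =
    ≡.cong (λ e → ≡.subst Tree e (node g (graft l j s) r)) (ℕₚ.≡-irrelevant _ (left-graft-arity a₁ a₂ b))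

  graft-node-right : ∀ {a₁ a₂ b} g (l : Tree a₁) (r : Tree a₂) (s : Tree b) i j → split a₁ a₂ i ≡ inj₂ j →
                     graft (node g l r) i s ≡ ≡.subst Tree (right-graft-arity a₁ a₂ b) (node g l (graft r j s))
  graft-node-right {a₁} {a₂} {b} g l r s i j split≡ with split a₁ a₂ i | split≡
  ... | _ | ≡.refl =
    ≡.cong (λ e → ≡.subst Tree e (node g l (graft r j s))) (ℕₚ.≡-irrelevant _ (right-graft-arity a₁ a₂ b))

  graft-subst : ∀ {a a' b} (e : a ≡ a') (t : Tree a) i (s : Tree b) →
                graft (≡.subst Tree e t) i s ≡
                ≡.subst Tree (≡.cong (_+ℕ b) e) (graft t (≡.subst (λ n → Fin (suc n)) (≡.sym e) i) s)
  graft-subst ≡.refl t i s = ≡.refl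

  subst-Tree-id : ∀ {a} (e : a ≡ a) (t : Tree a) → ≡.subst Tree e t ≡ t
  subst-Tree-id e t rewrite ℕₚ.≡-irrelevant e ≡.refl = ≡.refl

  split-last : ∀ a (i : Fin (suc (suc (a +ℕ 0)))) → toℕ i ≡ suc a → split a 0 i ≡ inj₂ zero
  split-last zero    (suc zero) _ = ≡.refl
  split-last (suc a) (suc i)    i≡ rewrite split-last a i (ℕₚ.suc-injective i≡) = ≡.refl

  toℕ-subst : ∀ {a a'} (e : a ≡ a') (i : Fin (suc a')) → toℕ (≡.subst (λ n → Fin (suc n)) (≡.sym e) i) ≡ toℕ i
  toℕ-subst ≡.refl i = ≡.refl

  graft-last-leaf : ∀ {a b} g (l : Tree a) (r : Tree b) (e : ℕ.suc (a +ℕ 0) ≡ ℕ.suc a) →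
                    graft (≡.subst Tree e (node g l leaf)) (fromℕ (suc a)) r ≡ node g l r
  graft-last-leaf {a} {b} g l r e =
    ≡.trans (graft-subst e (node g l leaf) (fromℕ (suc a)) r)
    (≡.trans (≡.cong (≡.subst Tree (≡.cong (_+ℕ b) e)) (graft-node-right g l leaf r i zero i-last))
    (≡.trans (≡.subst-subst (right-graft-arity a 0 b) {y≡z = ≡.cong (_+ℕ b) e})
             (subst-Tree-id _ (node g l r))))
    where
    i = ≡.subst (λ n → Fin (suc n)) (≡.sym e) (fromℕ (suc a))
    i-last : split a 0 i ≡ inj₂ zero
    i-last = split-last a i (≡.trans (toℕ-subst e (fromℕ (suc a))) (toℕ-fromℕ (suc a)))

  node-as-grafts : ∀ {a b} g (l : Tree a) (r : Tree b) → graft (graft (node g leaf leaf) zero l) (fromℕ (suc a)) r ≡ node g l r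
  node-as-grafts {a} g l r =
    ≡.trans (≡.cong (λ t → graft t (fromℕ (suc a)) r) (graft-node-left g leaf leaf l zero zero ≡.refl))
            (graft-last-leaf g l r (left-graft-arity 0 0 a))

  basis : ∀ {k} → Tree k → Lin k
  basis t = (1# , t) ∷ []

  basis-node≋compL : ∀ {a b} g (l : Tree a) (r : Tree b) →
                     basis (node g l r) ≋ compL (compL (genL g) zero (basis l)) (fromℕ (suc a)) (basis r)
  basis-node≋compL {a} g l r = mk≋ λ f → sym (begin
    ⟪ f , compL (compL (genL g) zero (basis l)) (fromℕ (suc a)) (basis r) ⟫
      ≈⟨ ⟪⟫-compL f (compL (genL g) zero (basis l)) (fromℕ (suc a)) (basis r) ⟩
    ⟪ (λ t → ⟪ (λ s → f (graft t (fromℕ (suc a)) s)) , basis r ⟫) , compL (genL g) zero (basis l) ⟫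
      ≈⟨ ⟪⟫-compL (λ t → ⟪ (λ s → f (graft t (fromℕ (suc a)) s)) , basis r ⟫) (genL g) zero (basis l) ⟩
    1# * (1# * (1# * f (graft (graft (node g leaf leaf) zero l) (fromℕ (suc a)) r) + 0#) + 0#) + 0#
      ≈⟨ trans (+-identityʳ _) (trans (*-identityˡ _) (trans (+-identityʳ _) (*-identityˡ _))) ⟩
    1# * f (graft (graft (node g leaf leaf) zero l) (fromℕ (suc a)) r) + 0#
      ≡⟨ ≡.cong (λ t → 1# * f t + 0#) (node-as-grafts g l r) ⟩
    ⟪ f , basis (node g l r) ⟫
      ∎)

  module Congruence {I : Set} (rel : I → Lin 2) where

    -- Unlike InIdeal rel (x ⊖ y), a record type lets Agda infer x and y.
    infix 4 _∼_
    record _∼_ {k} (x y : Lin k) : Set (c ⊔ ℓ) where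
      constructor fromIdeal
      field toIdeal : InIdeal rel (x ⊖ y)
    open _∼_ public

    InIdeal-resp-≋ : ∀ {k} {x y : Lin k} → x ≋ y → InIdeal rel x → InIdeal rel y
    InIdeal-resp-≋ x≋y = resp (≋⇒≈F x≋y)

    ∼-by : ∀ {k} {d x y : Lin k} → InIdeal rel d → d ≋ x ⊖ y → x ∼ y
    ∼-by d∈I d≋x⊖y = fromIdeal (InIdeal-resp-≋ d≋x⊖y d∈I)

    ≋⇒∼ : ∀ {k} {x y : Lin k} → x ≋ y → x ∼ y
    ≋⇒∼ x≋y = ∼-by zero (≋⇒zeroL≋⊖ x≋y)

    ∼-refl : ∀ {k} {x : Lin k} → x ∼ x
    ∼-refl = ≋⇒∼ (mk≋ λ _ → refl)

    ∼-sym : ∀ {k} {x y : Lin k} → x ∼ y → y ∼ x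
    ∼-sym {x = x} {y} (fromIdeal p) = ∼-by (scale -1# p) (-1#⊙[x⊖y]≋y⊖x x y)

    ∼-trans : ∀ {k} {x y z : Lin k} → x ∼ y → y ∼ z → x ∼ z
    ∼-trans {x = x} {y} {z} (fromIdeal p) (fromIdeal q) = ∼-by (add p q) ([x⊖y]⊕[y⊖z]≋x⊖z x y z)

    ⊕-cong : ∀ {k} {x x' y y' : Lin k} → x ∼ x' → y ∼ y' → x ⊕ y ∼ x' ⊕ y'
    ⊕-cong {x = x} {x'} {y} {y'} (fromIdeal p) (fromIdeal q) =
      ∼-by (add p q) ([x⊖x']⊕[y⊖y']≋[x⊕y]⊖[x'⊕y'] x x' y y')

    ⊙-cong : ∀ {k} κ {x x' : Lin k} → x ∼ x' → κ ⊙ x ∼ κ ⊙ x'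
    ⊙-cong κ {x} {x'} (fromIdeal p) = ∼-by (scale κ p) (⊙-distrib-⊖ κ x x')

    compL-cong : ∀ {a b} {x x' : Lin a} i {y y' : Lin b} → x ∼ x' → y ∼ y' → compL x i y ∼ compL x' i y'
    compL-cong {x = x} {x'} i {y} {y'} (fromIdeal p) (fromIdeal q) =
      ∼-trans (∼-by (compˡ i y p) (compL-distribʳ-⊖ x x' i y)) (∼-by (compʳ x' i q) (compL-distribˡ-⊖ x' i y y'))

    ∼-setoid : ℕ → Setoid c (c ⊔ ℓ)
    ∼-setoid k = record
      { Carrier       = Lin k
      ; _≈_           = _∼_
      ; isEquivalence = record { refl = ∼-refl ; sym = ∼-sym ; trans = ∼-trans }
      }

    module ∼-Reasoning {k : ℕ} = SetoidReasoning (∼-setoid k)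

module Zeta {c ℓ} (K : CharZeroField c ℓ) (γ : ℕ) where
  open CharZeroField K hiding (zero)
  open Operads K γ
  open Pairing commRing
  open SetoidReasoning setoid
  module A = FreeOperad K (Fin γ) _≟Fin_
  module D = FreeOperad K DGen _≟D_
  open D using (_≋_; mk≋; ⟪⟫-≈)

  forget : ∀ {k} → DD.Tree k → DA.Tree k
  forget DD.leaf              = DA.leaf
  forget (DD.node (≺ a) l r) = DA.node a (forget l) (forget r)
  forget (DD.node (≻ a) l r) = DA.node a (forget l) (forget r)

  nodeLin : ∀ {a b} → DGen → DD.Lin a → DD.Lin b → DD.Lin (ℕ.suc (a +ℕ b))
  nodeLin g x y = concatMap (uncurry λ λ' t → mapL (uncurry λ μ s → (λ' * μ , DD.node g t s)) y) x

  ⟪⟫-nodeLin : ∀ {a b} (f : DD.Tree (ℕ.suc (a +ℕ b)) → Carrier) g (x : DD.Lin a) (y : DD.Lin b) →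
               ⟪ f , nodeLin g x y ⟫ ≈ ⟪ (λ t → ⟪ (λ s → f (DD.node g t s)) , y ⟫) , x ⟫
  ⟪⟫-nodeLin f g x y = ⟪⟫-concatMap f _ _ (λ λ' t → ⟪⟫-map f _ λ' (DD.node g t) (λ _ _ → ≡.refl) y) x

  orientations : ∀ {k} → DA.Tree k → DD.Lin k
  orientations DA.leaf         = DD.unitL
  orientations (DA.node a l r) =
    nodeLin (≺ a) (orientations l) (orientations r) DD.⊕ nodeLin (≻ a) (orientations l) (orientations r)

  ζ-map : ∀ {k} → DA.Lin k → DD.Lin k
  ζ-map = concatMap (uncurry λ λ' t → λ' DD.⊙ orientations t)

  ⟪⟫-ζ-map : ∀ {k} (f : DD.Tree k → Carrier) x → ⟪ f , ζ-map x ⟫ ≈ ⟪ (λ t → ⟪ f , orientations t ⟫) , x ⟫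
  ⟪⟫-ζ-map f = ⟪⟫-concatMap f _ _ (λ λ' t → D.⟪⟫-⊙ f λ' (orientations t))

  ⟪_⟫ₙ : ∀ {a b} → (DD.Tree (ℕ.suc (a +ℕ b)) → Carrier) → DGen → DA.Tree a → DA.Tree b → Carrier
  ⟪ f ⟫ₙ σ l r = ⟪ (λ t → ⟪ (λ s → f (DD.node σ t s)) , orientations r ⟫) , orientations l ⟫

  ⟪⟫-orientations-node : ∀ {a b} (f : DD.Tree (ℕ.suc (a +ℕ b)) → Carrier) x (l : DA.Tree a) (r : DA.Tree b) →
                         ⟪ f , orientations (DA.node x l r) ⟫ ≈ ⟪ f ⟫ₙ (≺ x) l r + ⟪ f ⟫ₙ (≻ x) l r
  ⟪⟫-orientations-node f x l r =
    trans (⟪⟫-++ f (nodeLin (≺ x) oˡ oʳ) (nodeLin (≻ x) oˡ oʳ))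
          (+-cong (⟪⟫-nodeLin f (≺ x) oˡ oʳ) (⟪⟫-nodeLin f (≻ x) oˡ oʳ))
    where oˡ = orientations l
          oʳ = orientations r

  ⟪⟫-orientations-subst : ∀ {a a'} (e : a ≡ a') (t : DA.Tree a) (f : DD.Tree a' → Carrier) →
                          ⟪ f , orientations (≡.subst DA.Tree e t) ⟫ ≡
                          ⟪ (λ w → f (≡.subst DD.Tree e w)) , orientations t ⟫
  ⟪⟫-orientations-subst ≡.refl t f = ≡.refl

  split-DA≡DD : ∀ a b i → DA.split a b i ≡ DD.split a b i
  split-DA≡DD ℕ.zero    b zero    = ≡.refl
  split-DA≡DD ℕ.zero    b (suc i) = ≡.refl
  split-DA≡DD (ℕ.suc a) b zero    = ≡.refl
  split-DA≡DD (ℕ.suc a) b (suc i) = ≡.cong (Sum.map suc (λ j → j)) (split-DA≡DD a b i)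

  orientations-node-cong : ∀ {a b a' b'} x (f : DD.Tree (ℕ.suc (a' +ℕ b')) → Carrier) (l' : DA.Tree a') (r' : DA.Tree b')
                           (g : DD.Tree (ℕ.suc (a +ℕ b)) → Carrier) (l : DA.Tree a) (r : DA.Tree b) →
                           (∀ σ → ⟪ f ⟫ₙ σ l' r' ≈ ⟪ g ⟫ₙ σ l r) →
                           ⟪ f , orientations (DA.node x l' r') ⟫ ≈ ⟪ g , orientations (DA.node x l r) ⟫
  orientations-node-cong x f l' r' g l r f≈g = begin
    ⟪ f , orientations (DA.node x l' r') ⟫    ≈⟨ ⟪⟫-orientations-node f x l' r' ⟩
    ⟪ f ⟫ₙ (≺ x) l' r' + ⟪ f ⟫ₙ (≻ x) l' r'  ≈⟨ +-cong (f≈g (≺ x)) (f≈g (≻ x)) ⟩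
    ⟪ g ⟫ₙ (≺ x) l r + ⟪ g ⟫ₙ (≻ x) l r      ≈⟨ ⟪⟫-orientations-node g x l r ⟨
    ⟪ g , orientations (DA.node x l r) ⟫      ∎

  orientations-graft : ∀ {a b} (t : DA.Tree a) i (s : DA.Tree b) →
                       orientations (DA.graft t i s) ≋ DD.compL (orientations t) i (orientations s)
  orientations-graft-node : ∀ {a₁ a₂ b} x (l : DA.Tree a₁) (r : DA.Tree a₂) i (s : DA.Tree b) w →
                            DA.split a₁ a₂ i ≡ w →
                            orientations (DA.graft (DA.node x l r) i s) ≋
                            DD.compL (orientations (DA.node x l r)) i (orientations s)

  orientations-graft DA.leaf          zero s = mk≋ λ f →
    sym (trans (D.⟪⟫-compL f (orientations DA.leaf) zero (orientations s)) (trans (+-identityʳ _) (*-identityˡ _)))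
  orientations-graft (DA.node x l r) i    s = orientations-graft-node x l r i s _ ≡.refl

  orientations-graft-node {a₁} {a₂} {b} x l r i s (inj₁ j) split≡ = mk≋ pairing
    where
    E  = A.left-graft-arity a₁ a₂ b
    oˡ = orientations l
    oʳ = orientations r
    oˢ = orientations s

    pairing : ∀ f → ⟪ f , orientations (DA.graft (DA.node x l r) i s) ⟫ ≈
                    ⟪ f , DD.compL (orientations (DA.node x l r)) i oˢ ⟫
    pairing f = begin
      ⟪ f , orientations (DA.graft (DA.node x l r) i s) ⟫
        ≡⟨ ≡.cong (λ t → ⟪ f , orientations t ⟫) (A.graft-node-left x l r s i j split≡) ⟩
      ⟪ f , orientations (≡.subst DA.Tree E (DA.node x (DA.graft l j s) r)) ⟫
        ≡⟨ ⟪⟫-orientations-subst E _ f ⟩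
      ⟪ f∘E , orientations (DA.node x (DA.graft l j s) r) ⟫
        ≈⟨ orientations-node-cong x f∘E (DA.graft l j s) r F l r subtree ⟩
      ⟪ F , orientations (DA.node x l r) ⟫
        ≈⟨ D.⟪⟫-compL f (orientations (DA.node x l r)) i oˢ ⟨
      ⟪ f , DD.compL (orientations (DA.node x l r)) i oˢ ⟫
        ∎
      where
      f∘E = λ w → f (≡.subst DD.Tree E w)
      F   = λ t → ⟪ (λ s' → f (DD.graft t i s')) , oˢ ⟫

      subtree : ∀ σ → ⟪ f∘E ⟫ₙ σ (DA.graft l j s) r ≈ ⟪ F ⟫ₙ σ l r
      subtree σ = begin
        ⟪ (λ t → ⟪ (λ r' → f∘E (DD.node σ t r')) , oʳ ⟫) , orientations (DA.graft l j s) ⟫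
          ≈⟨ ⟪⟫-≈ (orientations-graft l j s) _ ⟩
        ⟪ (λ t → ⟪ (λ r' → f∘E (DD.node σ t r')) , oʳ ⟫) , DD.compL oˡ j oˢ ⟫
          ≈⟨ D.⟪⟫-compL _ oˡ j oˢ ⟩
        ⟪ (λ t → ⟪ (λ s' → ⟪ (λ r' → f∘E (DD.node σ (DD.graft t j s') r')) , oʳ ⟫) , oˢ ⟫) , oˡ ⟫
          ≈⟨ ⟪⟫-cong oˡ (λ t → ⟪⟫-swap _ oˢ oʳ) ⟩
        ⟪ (λ t → ⟪ (λ r' → ⟪ (λ s' → f∘E (DD.node σ (DD.graft t j s') r')) , oˢ ⟫) , oʳ ⟫) , oˡ ⟫
          ≈⟨ ⟪⟫-cong oˡ (λ t → ⟪⟫-cong oʳ (λ r' → ⟪⟫-cong oˢ (λ s' → reflexive (≡.cong f (≡.sym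
               (D.graft-node-left σ t r' s' i j (≡.trans (≡.sym (split-DA≡DD a₁ a₂ i)) split≡))))))) ⟩
        ⟪ F ⟫ₙ σ l r
          ∎
  orientations-graft-node {a₁} {a₂} {b} x l r i s (inj₂ j) split≡ = mk≋ pairing
    where
    E  = A.right-graft-arity a₁ a₂ b
    oˡ = orientations l
    oʳ = orientations r
    oˢ = orientations s

    pairing : ∀ f → ⟪ f , orientations (DA.graft (DA.node x l r) i s) ⟫ ≈
                    ⟪ f , DD.compL (orientations (DA.node x l r)) i oˢ ⟫
    pairing f = begin
      ⟪ f , orientations (DA.graft (DA.node x l r) i s) ⟫
        ≡⟨ ≡.cong (λ t → ⟪ f , orientations t ⟫) (A.graft-node-right x l r s i j split≡) ⟩
      ⟪ f , orientations (≡.subst DA.Tree E (DA.node x l (DA.graft r j s))) ⟫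
        ≡⟨ ⟪⟫-orientations-subst E _ f ⟩
      ⟪ f∘E , orientations (DA.node x l (DA.graft r j s)) ⟫
        ≈⟨ orientations-node-cong x f∘E l (DA.graft r j s) F l r subtree ⟩
      ⟪ F , orientations (DA.node x l r) ⟫
        ≈⟨ D.⟪⟫-compL f (orientations (DA.node x l r)) i oˢ ⟨
      ⟪ f , DD.compL (orientations (DA.node x l r)) i oˢ ⟫
        ∎
      where
      f∘E = λ w → f (≡.subst DD.Tree E w)
      F   = λ t → ⟪ (λ s' → f (DD.graft t i s')) , oˢ ⟫

      subtree : ∀ σ → ⟪ f∘E ⟫ₙ σ l (DA.graft r j s) ≈ ⟪ F ⟫ₙ σ l r
      subtree σ = begin
        ⟪ (λ t → ⟪ (λ r' → f∘E (DD.node σ t r')) , orientations (DA.graft r j s) ⟫) , oˡ ⟫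
          ≈⟨ ⟪⟫-cong oˡ (λ t → ⟪⟫-≈ (orientations-graft r j s) _) ⟩
        ⟪ (λ t → ⟪ (λ r' → f∘E (DD.node σ t r')) , DD.compL oʳ j oˢ ⟫) , oˡ ⟫
          ≈⟨ ⟪⟫-cong oˡ (λ t → D.⟪⟫-compL _ oʳ j oˢ) ⟩
        ⟪ (λ t → ⟪ (λ r' → ⟪ (λ s' → f∘E (DD.node σ t (DD.graft r' j s'))) , oˢ ⟫) , oʳ ⟫) , oˡ ⟫
          ≈⟨ ⟪⟫-cong oˡ (λ t → ⟪⟫-cong oʳ (λ r' → ⟪⟫-cong oˢ (λ s' → reflexive (≡.cong f (≡.sym
               (D.graft-node-right σ t r' s' i j (≡.trans (≡.sym (split-DA≡DD a₁ a₂ i)) split≡))))))) ⟩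
        ⟪ F ⟫ₙ σ l r
          ∎

  ζ-map-compL : ∀ {a b} (x : DA.Lin a) i (y : DA.Lin b) → ζ-map (DA.compL x i y) ≋ DD.compL (ζ-map x) i (ζ-map y)
  ζ-map-compL x i y = mk≋ λ f → let _∘graft_ = λ f t s → f (DD.graft t i s) in begin
    ⟪ f , ζ-map (DA.compL x i y) ⟫
      ≈⟨ ⟪⟫-ζ-map f (DA.compL x i y) ⟩
    ⟪ (λ t → ⟪ f , orientations t ⟫) , DA.compL x i y ⟫
      ≈⟨ A.⟪⟫-compL _ x i y ⟩
    ⟪ (λ t → ⟪ (λ s → ⟪ f , orientations (DA.graft t i s) ⟫) , y ⟫) , x ⟫
      ≈⟨ ⟪⟫-cong x (λ t → ⟪⟫-cong y (λ s →
           trans (⟪⟫-≈ (orientations-graft t i s) f) (D.⟪⟫-compL f (orientations t) i (orientations s)))) ⟩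
    ⟪ (λ t → ⟪ (λ s → ⟪ (λ t' → ⟪ f ∘graft t' , orientations s ⟫) , orientations t ⟫) , y ⟫) , x ⟫
      ≈⟨ ⟪⟫-cong x (λ t → ⟪⟫-swap (λ s t' → ⟪ f ∘graft t' , orientations s ⟫) y (orientations t)) ⟩
    ⟪ (λ t → ⟪ (λ t' → ⟪ (λ s → ⟪ f ∘graft t' , orientations s ⟫) , y ⟫) , orientations t ⟫) , x ⟫
      ≈⟨ ⟪⟫-cong x (λ t → ⟪⟫-cong (orientations t) (λ t' → ⟪⟫-ζ-map (f ∘graft t') y)) ⟨
    ⟪ (λ t → ⟪ (λ t' → ⟪ f ∘graft t' , ζ-map y ⟫) , orientations t ⟫) , x ⟫
      ≈⟨ ⟪⟫-ζ-map _ x ⟨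
    ⟪ (λ t' → ⟪ f ∘graft t' , ζ-map y ⟫) , ζ-map x ⟫
      ≈⟨ D.⟪⟫-compL f (ζ-map x) i (ζ-map y) ⟨
    ⟪ f , DD.compL (ζ-map x) i (ζ-map y) ⟫
      ∎

  ζ-map-⊕ : ∀ {k} (x y : DA.Lin k) → ζ-map (x DA.⊕ y) ≋ ζ-map x DD.⊕ ζ-map y
  ζ-map-⊕ x y = mk≋ λ f → let g = λ t → ⟪ f , orientations t ⟫ in begin
    ⟪ f , ζ-map (x DA.⊕ y) ⟫               ≈⟨ ⟪⟫-ζ-map f (x DA.⊕ y) ⟩
    ⟪ g , x DA.⊕ y ⟫                       ≈⟨ ⟪⟫-++ g x y ⟩
    ⟪ g , x ⟫ + ⟪ g , y ⟫                  ≈⟨ +-cong (⟪⟫-ζ-map f x) (⟪⟫-ζ-map f y) ⟨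
    ⟪ f , ζ-map x ⟫ + ⟪ f , ζ-map y ⟫      ≈⟨ ⟪⟫-++ f (ζ-map x) (ζ-map y) ⟨
    ⟪ f , ζ-map x DD.⊕ ζ-map y ⟫           ∎

  ζ-map-⊙ : ∀ {k} κ (x : DA.Lin k) → ζ-map (κ DA.⊙ x) ≋ κ DD.⊙ ζ-map x
  ζ-map-⊙ κ x = mk≋ λ f → let g = λ t → ⟪ f , orientations t ⟫ in begin
    ⟪ f , ζ-map (κ DA.⊙ x) ⟫    ≈⟨ ⟪⟫-ζ-map f (κ DA.⊙ x) ⟩
    ⟪ g , κ DA.⊙ x ⟫            ≈⟨ A.⟪⟫-⊙ g κ x ⟩
    κ * ⟪ g , x ⟫               ≈⟨ *-congˡ (⟪⟫-ζ-map f x) ⟨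
    κ * ⟪ f , ζ-map x ⟫         ≈⟨ D.⟪⟫-⊙ f κ (ζ-map x) ⟨
    ⟪ f , κ DD.⊙ ζ-map x ⟫      ∎

  ζ-map-⊖ : ∀ {k} (x y : DA.Lin k) → ζ-map (x DA.⊖ y) ≋ ζ-map x DD.⊖ ζ-map y
  ζ-map-⊖ x y = mk≋ λ f → begin
    ⟪ f , ζ-map (x DA.⊖ y) ⟫                         ≈⟨ ⟪⟫-≈ (ζ-map-⊕ x (-1# DA.⊙ y)) f ⟩
    ⟪ f , ζ-map x DD.⊕ ζ-map (-1# DA.⊙ y) ⟫          ≈⟨ ⟪⟫-++ f (ζ-map x) _ ⟩
    ⟪ f , ζ-map x ⟫ + ⟪ f , ζ-map (-1# DA.⊙ y) ⟫     ≈⟨ +-congˡ (⟪⟫-≈ (ζ-map-⊙ -1# y) f) ⟩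
    ⟪ f , ζ-map x ⟫ + ⟪ f , -1# DD.⊙ ζ-map y ⟫       ≈⟨ ⟪⟫-++ f (ζ-map x) _ ⟨
    ⟪ f , ζ-map x DD.⊖ ζ-map y ⟫                     ∎

  ζ-map-unitL : ζ-map DA.unitL ≋ DD.unitL
  ζ-map-unitL = mk≋ λ f → +-congʳ (*-congʳ (*-identityʳ 1#))

  ζ-map-genL : ∀ a → ζ-map (DA.genL a) ≋ ≺+≻ a
  ζ-map-genL a = mk≋ λ f → begin
    ⟪ f , ζ-map (DA.genL a) ⟫                                ≈⟨ ⟪⟫-ζ-map f (DA.genL a) ⟩
    1# * ⟪ f , orientations (DA.node a DA.leaf DA.leaf) ⟫ + 0# ≈⟨ trans (+-identityʳ _) (*-identityˡ _) ⟩
    ⟪ f , orientations (DA.node a DA.leaf DA.leaf) ⟫         ≈⟨ ⟪⟫-orientations-node f a DA.leaf DA.leaf ⟩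
    ⟪ f ⟫ₙ (≺ a) DA.leaf DA.leaf + ⟪ f ⟫ₙ (≻ a) DA.leaf DA.leaf ≈⟨ +-cong (+-identityʳ _) (+-identityʳ _) ⟩
    1# * ⟪ f , g≺ a ⟫ + 1# * ⟪ f , g≻ a ⟫                    ≈⟨ +-cong (*-identityˡ _) (*-identityˡ _) ⟩
    ⟪ f , g≺ a ⟫ + ⟪ f , g≻ a ⟫                              ≈⟨ ⟪⟫-++ f (g≺ a) (g≻ a) ⟨
    ⟪ f , ≺+≻ a ⟫                                            ∎

  ⌊≺≟≺⌋ : ∀ b a → ⌊ ≺ b ≟D ≺ a ⌋ ≡ ⌊ b ≟Fin a ⌋
  ⌊≺≟≺⌋ b a with b ≟Fin a
  ... | yes ≡.refl = ≡.refl
  ... | no _       = ≡.refl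

  ⌊≻≟≻⌋ : ∀ b a → ⌊ ≻ b ≟D ≻ a ⌋ ≡ ⌊ b ≟Fin a ⌋
  ⌊≻≟≻⌋ b a with b ≟Fin a
  ... | yes ≡.refl = ≡.refl
  ... | no _       = ≡.refl

  ⟪indicator⟫-orientations : ∀ {k k'} (w : DD.Tree k') (t : DA.Tree k) →
                             ⟪ (λ t' → indicator (DD.eqT w t')) , orientations t ⟫ ≈ indicator (DA.eqT (forget w) t)
  ⟪indicator⟫-orientations DD.leaf              DA.leaf = trans (+-identityʳ _) (*-identityˡ _)
  ⟪indicator⟫-orientations (DD.node (≺ b) _ _) DA.leaf = trans (+-identityʳ _) (zeroʳ _)
  ⟪indicator⟫-orientations (DD.node (≻ b) _ _) DA.leaf = trans (+-identityʳ _) (zeroʳ _)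
  ⟪indicator⟫-orientations DD.leaf (DA.node a l r) = begin
    ⟪ (λ t' → indicator (DD.eqT DD.leaf t')) , orientations (DA.node a l r) ⟫  ≈⟨ ⟪⟫-orientations-node _ a l r ⟩
    ⟪ (λ _ → 0#) ⟫ₙ (≺ a) l r + ⟪ (λ _ → 0#) ⟫ₙ (≻ a) l r                   ≈⟨ +-cong 0ₙ 0ₙ ⟩
    0# + 0#                                                                  ≈⟨ +-identityʳ 0# ⟩
    0#                                                                       ∎
    where 0ₙ = trans (⟪⟫-cong (orientations l) (λ _ → ⟪0⟫ (orientations r))) (⟪0⟫ (orientations l))
  ⟪indicator⟫-orientations (DD.node (≺ b) wl wr) (DA.node a l r) = begin
    ⟪ (λ t' → indicator (DD.eqT (DD.node (≺ b) wl wr) t')) , orientations (DA.node a l r) ⟫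
      ≈⟨ ⟪⟫-orientations-node _ a l r ⟩
    _ + _
      ≈⟨ +-cong (⟪indicator-∧⟫ ⌊ ≺ b ≟D ≺ a ⌋ _ _ (orientations l) (orientations r) ⟪wl⟫ ⟪wr⟫)
                (⟪indicator-∧⟫ false _ _ (orientations l) (orientations r) ⟪wl⟫ ⟪wr⟫) ⟩
    indicator (⌊ ≺ b ≟D ≺ a ⌋ ∧ _) + 0#
      ≈⟨ +-identityʳ _ ⟩
    indicator (⌊ ≺ b ≟D ≺ a ⌋ ∧ _)
      ≡⟨ ≡.cong (λ β → indicator (β ∧ _)) (⌊≺≟≺⌋ b a) ⟩
    indicator (DA.eqT (forget (DD.node (≺ b) wl wr)) (DA.node a l r))
      ∎
    where ⟪wl⟫ = ⟪indicator⟫-orientations wl l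
          ⟪wr⟫ = ⟪indicator⟫-orientations wr r
  ⟪indicator⟫-orientations (DD.node (≻ b) wl wr) (DA.node a l r) = begin
    ⟪ (λ t' → indicator (DD.eqT (DD.node (≻ b) wl wr) t')) , orientations (DA.node a l r) ⟫
      ≈⟨ ⟪⟫-orientations-node _ a l r ⟩
    _ + _
      ≈⟨ +-cong (⟪indicator-∧⟫ false _ _ (orientations l) (orientations r) ⟪wl⟫ ⟪wr⟫)
                (⟪indicator-∧⟫ ⌊ ≻ b ≟D ≻ a ⌋ _ _ (orientations l) (orientations r) ⟪wl⟫ ⟪wr⟫) ⟩
    0# + indicator (⌊ ≻ b ≟D ≻ a ⌋ ∧ _)
      ≈⟨ +-identityˡ _ ⟩
    indicator (⌊ ≻ b ≟D ≻ a ⌋ ∧ _)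
      ≡⟨ ≡.cong (λ β → indicator (β ∧ _)) (⌊≻≟≻⌋ b a) ⟩
    indicator (DA.eqT (forget (DD.node (≻ b) wl wr)) (DA.node a l r))
      ∎
    where ⟪wl⟫ = ⟪indicator⟫-orientations wl l
          ⟪wr⟫ = ⟪indicator⟫-orientations wr r

  coeff-ζ-map : ∀ {k} (w : DD.Tree k) x → DD.coeff w (ζ-map x) ≈ DA.coeff (forget w) x
  coeff-ζ-map w x = begin
    DD.coeff w (ζ-map x)                                                        ≈⟨ D.coeff≈⟪indicator⟫ w (ζ-map x) ⟩
    ⟪ (λ t' → indicator (DD.eqT w t')) , ζ-map x ⟫                              ≈⟨ ⟪⟫-ζ-map _ x ⟩
    ⟪ (λ t → ⟪ (λ t' → indicator (DD.eqT w t')) , orientations t ⟫) , x ⟫      ≈⟨ ⟪⟫-cong x (⟪indicator⟫-orientations w) ⟩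
    ⟪ (λ t → indicator (DA.eqT (forget w) t)) , x ⟫                             ≈⟨ A.coeff≈⟪indicator⟫ (forget w) x ⟨
    DA.coeff (forget w) x                                                       ∎

  ζ-map-resp-≈F : ∀ {k} {x y : DA.Lin k} → x DA.≈F y → ζ-map x DD.≈F ζ-map y
  ζ-map-resp-≈F {x = x} {y} x≈y w = trans (coeff-ζ-map w x) (trans (x≈y (forget w)) (sym (coeff-ζ-map w y)))

  ↓-idem : ∀ {n} (a : Fin n) → a ↓ a ≡ a
  ↓-idem zero    = ≡.refl
  ↓-idem (suc a) = ≡.cong suc (↓-idem a)

  ⟪ζ-map-◇∘◇⟫ : ∀ a i f → let _∘ᵢ_ = λ X Y → ⟪ f , DD.compL X i Y ⟫ in
                ⟪ f , ζ-map (DA.compL (◇ a) i (◇ a)) ⟫ ≈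
                (g≺ a ∘ᵢ g≺ a + g≺ a ∘ᵢ g≻ a) + (g≻ a ∘ᵢ g≺ a + g≻ a ∘ᵢ g≻ a)
  ⟪ζ-map-◇∘◇⟫ a i f = begin
    ⟪ f , ζ-map (DA.compL (◇ a) i (◇ a)) ⟫
      ≈⟨ ⟪⟫-≈ (ζ-map-compL (◇ a) i (◇ a)) f ⟩
    ⟪ f , DD.compL (ζ-map (◇ a)) i (ζ-map (◇ a)) ⟫
      ≈⟨ ⟪⟫-≈ (D.compL-resp-≋ i (ζ-map-genL a) (ζ-map-genL a)) f ⟩
    ⟪ f , DD.compL (g≺ a DD.⊕ g≻ a) i (g≺ a DD.⊕ g≻ a) ⟫
      ≈⟨ ⟪⟫-≈ (D.compL-distribʳ-⊕ (g≺ a) (g≻ a) i (≺+≻ a)) f ⟩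
    ⟪ f , DD.compL (g≺ a) i (≺+≻ a) DD.⊕ DD.compL (g≻ a) i (≺+≻ a) ⟫
      ≈⟨ ⟪⟫-++ f (DD.compL (g≺ a) i (≺+≻ a)) (DD.compL (g≻ a) i (≺+≻ a)) ⟩
    ⟪ f , DD.compL (g≺ a) i (≺+≻ a) ⟫ + ⟪ f , DD.compL (g≻ a) i (≺+≻ a) ⟫
      ≈⟨ +-cong (split (g≺ a)) (split (g≻ a)) ⟩
    (g≺ a ∘ᵢ g≺ a + g≺ a ∘ᵢ g≻ a) + (g≻ a ∘ᵢ g≺ a + g≻ a ∘ᵢ g≻ a)
      ∎
    where
    _∘ᵢ_ = λ X Y → ⟪ f , DD.compL X i Y ⟫
    split : ∀ X → ⟪ f , DD.compL X i (≺+≻ a) ⟫ ≈ X ∘ᵢ g≺ a + X ∘ᵢ g≻ a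
    split X = trans (⟪⟫-≈ (D.compL-distribˡ-⊕ X i (g≺ a) (g≻ a)) f)
                    (⟪⟫-++ f (DD.compL X i (g≺ a)) (DD.compL X i (g≻ a)))

  -- DendrRel (0 , a , a) ⊕ (DendrRel (1 , a , a) ⊕ DendrRel (2 , a , a)), with a ↓ a abstracted to m.
  dendriform-relations : Fin γ → Fin γ → DD.Lin 2
  dendriform-relations a m =
    (DD.compL (g≺ a) pos₁ (g≻ a) DD.⊖ DD.compL (g≻ a) pos₂ (g≺ a)) DD.⊕
    ((DD.compL (g≺ a) pos₁ (g≺ a) DD.⊖ (DD.compL (g≺ m) pos₂ (g≺ a) DD.⊕ DD.compL (g≺ m) pos₂ (g≻ a))) DD.⊕
     ((DD.compL (g≻ m) pos₁ (g≺ a) DD.⊕ DD.compL (g≻ m) pos₁ (g≻ a)) DD.⊖ DD.compL (g≻ a) pos₂ (g≻ a)))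

  dendriform-relations∈ideal : ∀ a → DD.InIdeal DendrRel (dendriform-relations a a)
  dendriform-relations∈ideal a = ≡.subst (λ m → DD.InIdeal DendrRel (dendriform-relations a m)) (↓-idem a)
    (DD.add (DD.gen (zero , a , a)) (DD.add (DD.gen (suc zero , a , a)) (DD.gen (suc (suc zero) , a , a))))

  ζ-map-DAsRel : ∀ a → ζ-map (DAsRel a) ≋ dendriform-relations a a
  ζ-map-DAsRel a = mk≋ pairing
    where
    open RingSolver (fromCommutativeRing commRing (λ _ → nothing)) using (solve; _⊕_; _⊗_; _⊜_)
    regroup : ∀ A B C D E F G H m →
              ((A + B) + (C + D)) + m * ((E + F) + (G + H)) ≈ (B + m * G) + ((A + m * (E + F)) + ((C + D) + m * H))
    regroup = solve 9 (λ A B C D E F G H m →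
        (((A ⊕ B) ⊕ (C ⊕ D)) ⊕ m ⊗ ((E ⊕ F) ⊕ (G ⊕ H)))
        ⊜ ((B ⊕ m ⊗ G) ⊕ ((A ⊕ m ⊗ (E ⊕ F)) ⊕ ((C ⊕ D) ⊕ m ⊗ H)))) refl

    pairing : ∀ f → ⟪ f , ζ-map (DAsRel a) ⟫ ≈ ⟪ f , dendriform-relations a a ⟫
    pairing f = begin
      ⟪ f , ζ-map (DAsRel a) ⟫
        ≈⟨ ⟪⟫-≈ (ζ-map-⊖ (DA.compL (◇ a) pos₁ (◇ a)) (DA.compL (◇ a) pos₂ (◇ a))) f ⟩
      ⟪ f , ζ-map (DA.compL (◇ a) pos₁ (◇ a)) DD.⊖ ζ-map (DA.compL (◇ a) pos₂ (◇ a)) ⟫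
        ≈⟨ D.⟪⟫-⊖ f (ζ-map (DA.compL (◇ a) pos₁ (◇ a))) (ζ-map (DA.compL (◇ a) pos₂ (◇ a))) ⟩
      ⟪ f , ζ-map (DA.compL (◇ a) pos₁ (◇ a)) ⟫ + -1# * ⟪ f , ζ-map (DA.compL (◇ a) pos₂ (◇ a)) ⟫
        ≈⟨ +-cong (⟪ζ-map-◇∘◇⟫ a pos₁ f) (*-congˡ (⟪ζ-map-◇∘◇⟫ a pos₂ f)) ⟩
      ((P ∘₁ P + P ∘₁ Q) + (Q ∘₁ P + Q ∘₁ Q)) + -1# * ((P ∘₂ P + P ∘₂ Q) + (Q ∘₂ P + Q ∘₂ Q))
        ≈⟨ regroup _ _ _ _ _ _ _ _ -1# ⟩
      (P ∘₁ Q + -1# * Q ∘₂ P) + ((P ∘₁ P + -1# * (P ∘₂ P + P ∘₂ Q)) + ((Q ∘₁ P + Q ∘₁ Q) + -1# * Q ∘₂ Q))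
        ≈⟨ +-cong (D.⟪⟫-⊖ f (P ·₁ Q) (Q ·₂ P))
                  (+-cong (trans (D.⟪⟫-⊖ f (P ·₁ P) (P ·₂ P DD.⊕ P ·₂ Q)) (+-congˡ (*-congˡ (⟪⟫-++ f (P ·₂ P) (P ·₂ Q)))))
                          (trans (D.⟪⟫-⊖ f (Q ·₁ P DD.⊕ Q ·₁ Q) (Q ·₂ Q)) (+-congʳ (⟪⟫-++ f (Q ·₁ P) (Q ·₁ Q))))) ⟨
      ⟪ f , R₁ ⟫ + (⟪ f , R₂ ⟫ + ⟪ f , R₃ ⟫)
        ≈⟨ trans (⟪⟫-++ f R₁ (R₂ DD.⊕ R₃)) (+-congˡ (⟪⟫-++ f R₂ R₃)) ⟨
      ⟪ f , dendriform-relations a a ⟫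
        ∎
      where
      P = g≺ a
      Q = g≻ a
      infix 30 _·₁_ _·₂_
      infix 8 _∘₁_ _∘₂_
      _·₁_ _·₂_ : DD.Lin 1 → DD.Lin 1 → DD.Lin 2
      X ·₁ Y = DD.compL X pos₁ Y
      X ·₂ Y = DD.compL X pos₂ Y
      _∘₁_ _∘₂_ : DD.Lin 1 → DD.Lin 1 → Carrier
      X ∘₁ Y = ⟪ f , X ·₁ Y ⟫
      X ∘₂ Y = ⟪ f , X ·₂ Y ⟫
      R₁ = P ·₁ Q DD.⊖ Q ·₂ P
      R₂ = P ·₁ P DD.⊖ (P ·₂ P DD.⊕ P ·₂ Q)
      R₃ = (Q ·₁ P DD.⊕ Q ·₁ Q) DD.⊖ Q ·₂ Q

  open D.Congruence DendrRel

  ζ-map-InIdeal : ∀ {k} {x : DA.Lin k} → DA.InIdeal DAsRel x → DD.InIdeal DendrRel (ζ-map x)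
  ζ-map-InIdeal (DA.gen a)                 =
    InIdeal-resp-≋ (D.≋-sym (ζ-map-DAsRel a)) (dendriform-relations∈ideal a)
  ζ-map-InIdeal DA.zero                    = DD.zero
  ζ-map-InIdeal (DA.add {x = x} {y} p q)   =
    InIdeal-resp-≋ (D.≋-sym (ζ-map-⊕ x y)) (DD.add (ζ-map-InIdeal p) (ζ-map-InIdeal q))
  ζ-map-InIdeal (DA.scale κ {x} p)         =
    InIdeal-resp-≋ (D.≋-sym (ζ-map-⊙ κ x)) (DD.scale κ (ζ-map-InIdeal p))
  ζ-map-InIdeal (DA.compˡ {x = x} i y p)   =
    InIdeal-resp-≋ (D.≋-sym (ζ-map-compL x i y)) (DD.compˡ i (ζ-map y) (ζ-map-InIdeal p))
  ζ-map-InIdeal (DA.compʳ x i {y} p)       =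
    InIdeal-resp-≋ (D.≋-sym (ζ-map-compL x i y)) (DD.compʳ (ζ-map x) i (ζ-map-InIdeal p))
  ζ-map-InIdeal (DA.resp {x = x} {y} x≈y p) = DD.resp (ζ-map-resp-≈F {x = x} {y} x≈y) (ζ-map-InIdeal p)

  ζ : Morphism DAs Dendr
  ζ = record
    { map   = ζ-map
    ; map-≈ = λ {_} {x} {y} x∼y → InIdeal-resp-≋ (ζ-map-⊖ x y) (ζ-map-InIdeal x∼y)
    ; map-+ = λ x y → toIdeal (≋⇒∼ (ζ-map-⊕ x y))
    ; map-· = λ κ x → toIdeal (≋⇒∼ (ζ-map-⊙ κ x))
    ; map-∘ = λ x i y → toIdeal (≋⇒∼ (ζ-map-compL x i y))
    ; map-𝟙 = toIdeal (≋⇒∼ ζ-map-unitL)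
    }

  ζ-extends : Extends ζ
  ζ-extends a = toIdeal (≋⇒∼ (ζ-map-genL a))

module Uniqueness {c ℓ} (K : CharZeroField c ℓ) (γ : ℕ) where
  open CharZeroField K hiding (zero)
  open Operads K γ
  module A = FreeOperad K (Fin γ) _≟Fin_
  module D = FreeOperad K DGen _≟D_
  open D using (mk≋)
  open D.Congruence DendrRel
  open ∼-Reasoning

  module Extension (φ : Morphism DAs Dendr) (φ-extends : Extends φ) where
    open Morphism φ

    map-+∼ : ∀ {k} (x y : DA.Lin k) → map (x DA.⊕ y) ∼ map x DD.⊕ map y
    map-+∼ x y = fromIdeal (map-+ x y)

    map-·∼ : ∀ {k} κ (x : DA.Lin k) → map (κ DA.⊙ x) ∼ κ DD.⊙ map x
    map-·∼ κ x = fromIdeal (map-· κ x)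

    map-∘∼ : ∀ {a b} (x : DA.Lin a) i (y : DA.Lin b) → map (DA.compL x i y) ∼ DD.compL (map x) i (map y)
    map-∘∼ x i y = fromIdeal (map-∘ x i y)

    map-𝟙∼ : map DA.unitL ∼ DD.unitL
    map-𝟙∼ = fromIdeal map-𝟙

    map-◇∼ : ∀ a → map (◇ a) ∼ ≺+≻ a
    map-◇∼ a = fromIdeal (φ-extends a)

    map-resp-≋ : ∀ {k} {x y : DA.Lin k} → x A.≋ y → map x ∼ map y
    map-resp-≋ x≋y = fromIdeal (map-≈ (A.Congruence.toIdeal (A.Congruence.≋⇒∼ DAsRel x≋y)))

    map-[] : ∀ {k} → map {k} [] ∼ []
    map-[] = begin
      map (0# DA.⊙ [])    ≈⟨ map-·∼ 0# [] ⟩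
      0# DD.⊙ map []      ≈⟨ ≋⇒∼ (mk≋ λ f → trans (D.⟪⟫-⊙ f 0# (map [])) (zeroˡ _)) ⟩
      []                  ∎

    map-∷ : ∀ {k} λ' (t : DA.Tree k) x → map ((λ' , t) ∷ x) ∼ (λ' DD.⊙ map (A.basis t)) DD.⊕ map x
    map-∷ λ' t x = begin
      map ((λ' , t) ∷ x)                     ≈⟨ map-+∼ ((λ' , t) ∷ []) x ⟩
      map ((λ' , t) ∷ []) DD.⊕ map x         ≈⟨ ⊕-cong (map-resp-≋ (A.mk≋ λ f → +-congʳ (*-congʳ (sym (*-identityʳ λ'))))) ∼-refl ⟩
      map (λ' DA.⊙ A.basis t) DD.⊕ map x     ≈⟨ ⊕-cong (map-·∼ λ' (A.basis t)) ∼-refl ⟩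
      (λ' DD.⊙ map (A.basis t)) DD.⊕ map x   ∎

    map-node : ∀ {a b} x (l : DA.Tree a) (r : DA.Tree b) →
               map (A.basis (DA.node x l r)) ∼
               DD.compL (DD.compL (≺+≻ x) zero (map (A.basis l))) (fromℕ (ℕ.suc a)) (map (A.basis r))
    map-node {a} x l r = begin
      map (A.basis (DA.node x l r))
        ≈⟨ map-resp-≋ (A.basis-node≋compL x l r) ⟩
      map (DA.compL (DA.compL (◇ x) zero (A.basis l)) (fromℕ (ℕ.suc a)) (A.basis r))
        ≈⟨ map-∘∼ (DA.compL (◇ x) zero (A.basis l)) (fromℕ (ℕ.suc a)) (A.basis r) ⟩
      DD.compL (map (DA.compL (◇ x) zero (A.basis l))) (fromℕ (ℕ.suc a)) (map (A.basis r))
        ≈⟨ compL-cong (fromℕ (ℕ.suc a)) (map-∘∼ (◇ x) zero (A.basis l)) ∼-refl ⟩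
      DD.compL (DD.compL (map (◇ x)) zero (map (A.basis l))) (fromℕ (ℕ.suc a)) (map (A.basis r))
        ≈⟨ compL-cong (fromℕ (ℕ.suc a)) (compL-cong zero (map-◇∼ x) ∼-refl) ∼-refl ⟩
      DD.compL (DD.compL (≺+≻ x) zero (map (A.basis l))) (fromℕ (ℕ.suc a)) (map (A.basis r))
        ∎

  extensions-agree : ∀ φ ψ → Extends φ → Extends ψ → ∀ {k} (x : DA.Lin k) →
                     LinOperad._≈_ Dendr (Morphism.map φ x) (Morphism.map ψ x)
  extensions-agree φ ψ φ-extends ψ-extends x = toIdeal (on-Lin x)
    where
    module Φ = Extension φ φ-extends
    module Ψ = Extension ψ ψ-extends

    on-trees : ∀ {k} (t : DA.Tree k) → Morphism.map φ (A.basis t) ∼ Morphism.map ψ (A.basis t)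
    on-trees DA.leaf = begin
      Morphism.map φ DA.unitL   ≈⟨ Φ.map-𝟙∼ ⟩
      DD.unitL                  ≈⟨ Ψ.map-𝟙∼ ⟨
      Morphism.map ψ DA.unitL   ∎
    on-trees (DA.node {a} x l r) = begin
      Morphism.map φ (A.basis (DA.node x l r))
        ≈⟨ Φ.map-node x l r ⟩
      DD.compL (DD.compL (≺+≻ x) zero (Morphism.map φ (A.basis l))) (fromℕ (ℕ.suc a)) (Morphism.map φ (A.basis r))
        ≈⟨ compL-cong (fromℕ (ℕ.suc a)) (compL-cong zero (∼-refl {x = ≺+≻ x}) (on-trees l)) (on-trees r) ⟩
      DD.compL (DD.compL (≺+≻ x) zero (Morphism.map ψ (A.basis l))) (fromℕ (ℕ.suc a)) (Morphism.map ψ (A.basis r))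
        ≈⟨ Ψ.map-node x l r ⟨
      Morphism.map ψ (A.basis (DA.node x l r))
        ∎

    on-Lin : ∀ {k} (x : DA.Lin k) → Morphism.map φ x ∼ Morphism.map ψ x
    on-Lin [] = ∼-trans Φ.map-[] (∼-sym Ψ.map-[])
    on-Lin ((λ' , t) ∷ x) = begin
      Morphism.map φ ((λ' , t) ∷ x)                                   ≈⟨ Φ.map-∷ λ' t x ⟩
      (λ' DD.⊙ Morphism.map φ (A.basis t)) DD.⊕ Morphism.map φ x      ≈⟨ ⊕-cong (⊙-cong λ' (on-trees t)) (on-Lin x) ⟩
      (λ' DD.⊙ Morphism.map ψ (A.basis t)) DD.⊕ Morphism.map ψ x      ≈⟨ Ψ.map-∷ λ' t x ⟨
      Morphism.map ψ ((λ' , t) ∷ x)                                   ∎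

proposition3p2p2 : ∀ {c ℓ : Level} (K : CharZeroField c ℓ) (γ : ℕ) →
    Σ (Morphism (Operads.DAs K γ) (Operads.Dendr K γ)) λ ζ →
      Operads.Extends K γ ζ ×
      (∀ (ψ : Morphism (Operads.DAs K γ) (Operads.Dendr K γ)) →
         Operads.Extends K γ ψ →
         ∀ {k} (x : LinOperad.Op (Operads.DAs K γ) k) →
           LinOperad._≈_ (Operads.Dendr K γ) (Morphism.map ψ x) (Morphism.map ζ x))
proposition3p2p2 K γ = ζ , ζ-extends , λ ψ ψ-extends → extensions-agree ψ ζ ψ-extends ζ-extends
  where
  open Zeta K γ using (ζ; ζ-extends)
  open Uniqueness K γ using (extensions-agree)
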